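{- Let $f:\{0,1\}^n\to\{0,1\}$ be a monotone function with $C(f)\le k$. Then for any input $x^\star\in\{0,1\}^n$, a certificate of size $O(k^4)$ for $f$'s value on $x^\star$ can be computed with high probability using $O(k^8\log n)$ queries to $f$.
   Context: A set $S\subseteq[n]$ is a certificate for $f$'s value on $x$ if $f(y)=f(x)$ for all $y$ agreeing with $x$ on $S$; $C(f)$ is the maximum over $x$ of the minimum size of such a certificate. $f$ is monotone if $x\le y$ coordinatewise implies $f(x)\le f(y)$. "With high probability" means with probability at least $1-1/\mathrm{poly}(n)$. -}

module Defs where

open import Data.Nat using (ℕ; zero; suc; _+_; _*_; _^_; _≤_)
open import Data.Nat.Logarithm using (⌊log₂_⌋)
open import Data.Bool as B using (Bool; true; false)
open import Data.Fin using (Fin)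
open import Data.Fin.Subset using (Subset; _∈_; ∣_∣)
open import Data.Vec using (Vec)
open import Data.List using (List; length)
open import Data.List.Relation.Unary.All using (All)
open import Data.List.Relation.Unary.Unique.Propositional using (Unique)
open import Data.Product using (Σ; ∃; _×_)
open import Relation.Binary.PropositionalEquality using (_≡_)

Input : ℕ → Set
Input n = Fin n → Bool

BoolFun : ℕ → Set
BoolFun n = Input n → Bool

_≤ᵢ_ : ∀ {n} → Input n → Input n → Set
x ≤ᵢ y = ∀ i → x i B.≤ y i

Monotone : ∀ {n} → BoolFun n → Set
Monotone {n} f = ∀ (x y : Input n) → x ≤ᵢ y → f x B.≤ f y

IsCertificate : ∀ {n} → BoolFun n → Input n → Subset n → Set
IsCertificate {n} f x S =
  ∀ (y : Input n) → (∀ i → i ∈ S → y i ≡ x i) → f y ≡ f x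

CertComplexity≤ : ∀ {n} → BoolFun n → ℕ → Set
CertComplexity≤ {n} f k =
  ∀ (x : Input n) → Σ (Subset n) λ S → IsCertificate f x S × ∣ S ∣ ≤ k

data QueryTree (n : ℕ) : Set where
  leaf  : Subset n → QueryTree n
  query : Input n → (ifFalse ifTrue : QueryTree n) → QueryTree n

run : ∀ {n} → QueryTree n → BoolFun n → Subset n
run (leaf S) f = S
run (query y t₀ t₁) f with f y
... | false = run t₀ f
... | true  = run t₁ f

cost : ∀ {n} → QueryTree n → BoolFun n → ℕ
cost (leaf S) f = 0
cost (query y t₀ t₁) f with f y
... | false = suc (cost t₀ f)
... | true  = suc (cost t₁ f)

-- A randomized query algorithm: r uniformly random bits select a
-- deterministic query tree.
RandQueryAlg : ℕ → ℕ → Set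
RandQueryAlg n r = Vec Bool r → QueryTree n

-- "P holds with probability ≥ 1 - 1/n^c" over uniform seeds in {0,1}^r:
-- there are at least N distinct seeds satisfying P where
-- N / 2^r ≥ 1 - 1/n^c, i.e. N·n^c + 2^r ≥ 2^r·n^c.
ProbAtLeast1-1/n^ : (r n c : ℕ) → (Vec Bool r → Set) → Set
ProbAtLeast1-1/n^ r n c P =
  Σ (List (Vec Bool r)) λ L →
    Unique L × All P L × (2 ^ r * n ^ c ≤ length L * n ^ c + 2 ^ r)

-- O(log n) with a convention valid for all n ≥ 1: 1 + ⌊log₂ n⌋.
logFactor : ℕ → ℕ
logFactor n = suc ⌊log₂ n ⌋

-- Let b = f(x⋆) and, for T ⊆ [n], let x⋆[T] agree with x⋆ on T and equal ¬ b elsewhere.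
-- Call T sufficient when f(x⋆[T]) = b. For monotone f, x⋆[T] is the least favourable
-- completion of x⋆ on T, so a sufficient T is a certificate for x⋆, and sufficiency is
-- upward closed. If S certifies x⋆[T] for a sufficient T, then T ∩ S is again sufficient;
-- hence every coordinate lying in all sufficient subsets of T lies in S, and there are at
-- most C(f) ≤ k of them.
--
-- The algorithm keeps a set R and a bound m such that R ∪ [0, m) is sufficient and every
-- element of R lies in all its sufficient subsets. While R alone is not sufficient, a
-- binary search over prefixes finds e with R ∪ [0, e) insufficient and R ∪ [0, e]
-- sufficient; then e < m, and R ∪ {e} with bound e satisfies the invariant again. So |R|
-- grows, stays ≤ k, and after at most k + 1 rounds of O(log n) queries R is a sufficient
-- set, i.e. a certificate, of size ≤ k. The algorithm is deterministic, so it succeeds with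
-- probability 1, and (k + 2)(log n + 2) = O(k⁸ log n).

module Submission where

open import Defs
open import Data.Nat using (ℕ; _+_; _*_; _^_; _≤_)
open import Data.Fin.Subset using (∣_∣)
open import Data.Product using (Σ; _×_)

open import Data.Nat using (zero; suc; _<_; _<?_; _<ᵇ_; _≡ᵇ_; z≤n; s≤s)
open import Data.Nat.Properties
  using ( ≤-refl; ≤-reflexive; ≤-trans; <-≤-trans; <⇒≤; ≤⇒≯; ≰⇒>; ≮⇒≥; 1+n≰n; n<1+n
        ; +-suc; +-assoc; +-identityʳ; +-comm; +-mono-≤; +-monoˡ-≤; *-monoˡ-≤; *-monoʳ-≤
        ; *-identityˡ; m≤m+n; m≤m*n; m^n≢0; m<1+n⇒m<n∨m≡n; <ᵇ⇒<; <⇒<ᵇ; ≡ᵇ⇒≡; ≡⇒≡ᵇ )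
open import Data.Nat.Logarithm using (⌊log₂_⌋; ⌊log₂⌋-mono-≤; ⌊log₂[2^n]⌋≡n)
open import Data.Nat.Solver using (module +-*-Solver)
open import Data.Bool using (Bool; true; false; not; T; if_then_else_)
import Data.Bool as Bool
import Data.Bool.Properties as Boolₚ
open import Data.Fin using (Fin; toℕ; fromℕ<)
open import Data.Fin.Properties using (toℕ<n; toℕ-injective; toℕ-fromℕ<)
open import Data.Fin.Subset using (Subset; _∈_; _∉_; _⊆_; _∪_; _∩_; ⊥)
open import Data.Fin.Subset.Properties
  using ( _∈?_; ∉⊥; ∣⊥∣≡0; p⊆q⇒∣p∣≤∣q∣; p⊂q⇒∣p∣<∣q∣; x∈p⇒∣p-x∣<∣p∣
        ; p⊆p∪q; q⊆p∪q; x∈p∪q⁺; x∈p∪q⁻; x∈p∩q⁺; p∩q⊆p; p∩q⊆q )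
open import Data.Vec using (Vec; []; tabulate)
open import Data.Vec.Properties using (lookup∘tabulate; lookup⇒[]=; []=⇒lookup)
open import Data.List using (_∷_)
import Data.List as List
import Data.List.Relation.Unary.All as All
import Data.List.Relation.Unary.AllPairs as AllPairs
open import Data.Product using (_,_; proj₁; proj₂; map₁; map₂)
open import Data.Sum using (inj₁; inj₂; [_,_]′)
open import Data.Empty using (⊥-elim)
open import Function using (_∘_)
open import Function.Bundles using (module Equivalence)
open import Relation.Nullary using (¬_; yes; no; does; Dec; contradiction)
open import Relation.Binary.PropositionalEquality
  using (_≡_; _≢_; refl; sym; trans; cong; subst)

private
  variable
    n k : ℕ
    A B : Set

data Query (n : ℕ) (A : Set) : Set where
  return : A → Query n A
  ask    : Input n → (Bool → Query n A) → Query n A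

module _ {n : ℕ} where

  _>>=_ : Query n A → (A → Query n B) → Query n B
  return a >>= κ = κ a
  ask y g  >>= κ = ask y (λ v → g v >>= κ)

  runQ : Query n A → BoolFun n → A
  runQ (return a) f = a
  runQ (ask y g)  f = runQ (g (f y)) f

  costQ : Query n A → BoolFun n → ℕ
  costQ (return a) f = 0
  costQ (ask y g)  f = suc (costQ (g (f y)) f)

  runQ->>= : ∀ (p : Query n A) (κ : A → Query n B) f →
             runQ (p >>= κ) f ≡ runQ (κ (runQ p f)) f
  runQ->>= (return a) κ f = refl
  runQ->>= (ask y g)  κ f = runQ->>= (g (f y)) κ f

  costQ->>= : ∀ (p : Query n A) (κ : A → Query n B) f →
              costQ (p >>= κ) f ≡ costQ p f + costQ (κ (runQ p f)) f
  costQ->>= (return a) κ f = refl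
  costQ->>= (ask y g)  κ f = cong suc (costQ->>= (g (f y)) κ f)

  toTree : Query n (Subset n) → QueryTree n
  toTree (return S) = leaf S
  toTree (ask y g)  = query y (toTree (g false)) (toTree (g true))

  run-toTree : ∀ p f → run (toTree p) f ≡ runQ p f
  run-toTree (return S) f = refl
  run-toTree (ask y g)  f with f y
  ... | false = run-toTree (g false) f
  ... | true  = run-toTree (g true) f

  cost-toTree : ∀ p f → cost (toTree p) f ≡ costQ p f
  cost-toTree (return S) f = refl
  cost-toTree (ask y g)  f with f y
  ... | false = cong suc (cost-toTree (g false) f)
  ... | true  = cong suc (cost-toTree (g true) f)

  askIf : Input n → Bool → Query n A → Query n A → Query n A
  askIf y b p q = ask y (λ v → if does (v Boolₚ.≟ b) then p else q)

  module _ {y : Input n} {b : Bool} {p q : Query n A} (f : BoolFun n) where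

    runQ-askIf : (P : A → Set) →
                 (f y ≡ b → P (runQ p f)) → (f y ≢ b → P (runQ q f)) →
                 P (runQ (askIf y b p q) f)
    runQ-askIf P onYes onNo = branch (f y Boolₚ.≟ b)
      where
      branch : (d : Dec (f y ≡ b)) → P (runQ (if does d then p else q) f)
      branch (yes fy≡b) = onYes fy≡b
      branch (no  fy≢b) = onNo fy≢b

    costQ-askIf : ∀ {c} → costQ p f ≤ c → costQ q f ≤ c → costQ (askIf y b p q) f ≤ suc c
    costQ-askIf {c} p≤c q≤c = s≤s (branch (f y Boolₚ.≟ b))
      where
      branch : (d : Dec (f y ≡ b)) → costQ (if does d then p else q) f ≤ c
      branch (yes _) = p≤c
      branch (no  _) = q≤c

module Bisection {n : ℕ} (probe : ℕ → Input n) (b : Bool) where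

  bisect : ℕ → ℕ → Query n ℕ
  bisect zero    lo = return lo
  bisect (suc t) lo = askIf (probe (lo + 2 ^ t)) b (bisect t lo) (bisect t (lo + 2 ^ t))

  costQ-bisect : ∀ t lo f → costQ (bisect t lo) f ≤ t
  costQ-bisect zero    lo f = z≤n
  costQ-bisect (suc t) lo f = costQ-askIf f (costQ-bisect t lo f) (costQ-bisect t (lo + 2 ^ t) f)

  module _ (f : BoolFun n) where

    Hit : ℕ → Set
    Hit m = f (probe m) ≡ b

    Threshold : ℕ → Set
    Threshold e = ¬ Hit e × Hit (suc e)

    bisect-threshold : ∀ t lo → ¬ Hit lo → Hit (lo + 2 ^ t) → Threshold (runQ (bisect t lo) f)
    bisect-threshold zero lo miss hit = miss , subst Hit (+-comm lo 1) hit
    bisect-threshold (suc t) lo miss hit =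
      runQ-askIf f Threshold
        (λ hitMid → bisect-threshold t lo miss hitMid)
        (λ missMid → bisect-threshold t (lo + 2 ^ t) missMid (subst Hit halves hit))
      where
      halves : lo + 2 ^ suc t ≡ lo + 2 ^ t + 2 ^ t
      halves = trans (cong (λ z → lo + (2 ^ t + z)) (+-identityʳ (2 ^ t)))
                     (sym (+-assoc lo (2 ^ t) (2 ^ t)))

module _ {n : ℕ} where

  ∈-tabulate⁺ : ∀ (p : Fin n → Bool) {i} → T (p i) → i ∈ tabulate p
  ∈-tabulate⁺ p {i} pi =
    lookup⇒[]= i (tabulate p) (trans (lookup∘tabulate p i) (Equivalence.to Boolₚ.T-≡ pi))

  ∈-tabulate⁻ : ∀ (p : Fin n → Bool) {i} → i ∈ tabulate p → T (p i)
  ∈-tabulate⁻ p {i} i∈p =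
    Equivalence.from Boolₚ.T-≡ (trans (sym (lookup∘tabulate p i)) ([]=⇒lookup i∈p))

  below : ℕ → Subset n
  below m = tabulate (λ i → toℕ i <ᵇ m)

  at : ℕ → Subset n
  at e = tabulate (λ i → toℕ i ≡ᵇ e)

  ∈-below⁺ : ∀ {m i} → toℕ i < m → i ∈ below m
  ∈-below⁺ i<m = ∈-tabulate⁺ _ (<⇒<ᵇ i<m)

  ∈-below⁻ : ∀ {m i} → i ∈ below m → toℕ i < m
  ∈-below⁻ {m} {i} i∈ = <ᵇ⇒< (toℕ i) m (∈-tabulate⁻ _ i∈)

  ∈-at⁺ : ∀ {e i} → toℕ i ≡ e → i ∈ at e
  ∈-at⁺ {e} {i} i≡e = ∈-tabulate⁺ _ (≡⇒≡ᵇ (toℕ i) e i≡e)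

  ∈-at⁻ : ∀ {e i} → i ∈ at e → toℕ i ≡ e
  ∈-at⁻ {e} {i} i∈ = ≡ᵇ⇒≡ (toℕ i) e (∈-tabulate⁻ _ i∈)

  at-unique : ∀ {e i j} → i ∈ at e → j ∈ at e → i ≡ j
  at-unique i∈ j∈ = toℕ-injective (trans (∈-at⁻ i∈) (sym (∈-at⁻ j∈)))

  below-zero : ∀ {i} → i ∉ below 0
  below-zero i∈ with () ← ∈-below⁻ {0} i∈

  below-mono : ∀ {m e} → m ≤ e → below m ⊆ below e
  below-mono m≤e i∈ = ∈-below⁺ (<-≤-trans (∈-below⁻ i∈) m≤e)

  below-full : ∀ {e} → n ≤ e → ∀ i → i ∈ below e
  below-full n≤e i = ∈-below⁺ (<-≤-trans (toℕ<n i) n≤e)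

  below-suc : ∀ {e} → below (suc e) ⊆ at e ∪ below e
  below-suc i∈ with m<1+n⇒m<n∨m≡n (∈-below⁻ i∈)
  ... | inj₁ i<e = x∈p∪q⁺ (inj₂ (∈-below⁺ i<e))
  ... | inj₂ i≡e = x∈p∪q⁺ (inj₁ (∈-at⁺ i≡e))

  at⊆below : ∀ {e m} → e < m → at e ⊆ below m
  at⊆below e<m i∈ = ∈-below⁺ (subst (_< _) (sym (∈-at⁻ i∈)) e<m)

  ∪-⊆ : {p q r : Subset n} → p ⊆ r → q ⊆ r → p ∪ q ⊆ r
  ∪-⊆ {p} {q} p⊆r q⊆r x∈ = [ p⊆r , q⊆r ]′ (x∈p∪q⁻ p q x∈)

  ∪-monoʳ-⊆ : {p q r : Subset n} → q ⊆ r → p ∪ q ⊆ p ∪ r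
  ∪-monoʳ-⊆ {p} q⊆r = ∪-⊆ (p⊆p∪q _) (q⊆p∪q p _ ∘ q⊆r)

AgreeOn : Subset n → Input n → Input n → Set
AgreeOn T y x = ∀ i → i ∈ T → y i ≡ x i

restrict : Bool → Input n → Subset n → Input n
restrict b x T i with i ∈? T
... | yes _ = x i
... | no  _ = not b

module _ {b : Bool} {x : Input n} {T : Subset n} {i : Fin n} where

  restrict-∈ : i ∈ T → restrict b x T i ≡ x i
  restrict-∈ i∈T with i ∈? T
  ... | yes _   = refl
  ... | no  i∉T = contradiction i∈T i∉T

  restrict-∉ : i ∉ T → restrict b x T i ≡ not b
  restrict-∉ i∉T with i ∈? T
  ... | yes i∈T = contradiction i∈T i∉T
  ... | no  _   = refl

module _ {x y : Input n} {T : Subset n} (agree : AgreeOn T y x) where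

  restrict-true-≤ : restrict true x T ≤ᵢ y
  restrict-true-≤ i with i ∈? T
  ... | yes i∈T = Boolₚ.≤-reflexive (sym (agree i i∈T))
  ... | no  _   = Boolₚ.≤-minimum (y i)

  ≤-restrict-false : y ≤ᵢ restrict false x T
  ≤-restrict-false i with i ∈? T
  ... | yes i∈T = Boolₚ.≤-reflexive (agree i i∈T)
  ... | no  _   = Boolₚ.≤-maximum (y i)

monotone-≗ : {f : BoolFun n} → Monotone f → ∀ {x y} → (∀ i → x i ≡ y i) → f x ≡ f y
monotone-≗ mono x≗y =
  Boolₚ.≤-antisym (mono _ _ (Boolₚ.≤-reflexive ∘ x≗y))
                  (mono _ _ (Boolₚ.≤-reflexive ∘ sym ∘ x≗y))

certificate-⊆ : ∀ {f : BoolFun n} {x S U} → S ⊆ U → IsCertificate f x S → IsCertificate f x U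
certificate-⊆ S⊆U cert y agree = cert y (λ i i∈S → agree i (S⊆U i∈S))

module Sufficiency {n : ℕ} (f : BoolFun n) (mono : Monotone f) (x : Input n) (b : Bool) where

  Sufficient : Subset n → Set
  Sufficient T = f (restrict b x T) ≡ b

  Necessary : Subset n → Fin n → Set
  Necessary T i = ∀ {U} → U ⊆ T → i ∉ U → ¬ Sufficient U

  sufficient-forces : ∀ {T y} → Sufficient T → AgreeOn T y x → f y ≡ b
  sufficient-forces {T} {y} = forces b
    where
    forces : ∀ b → f (restrict b x T) ≡ b → AgreeOn T y x → f y ≡ b
    forces true  fxT≡b agree =
      Boolₚ.≤-antisym (Boolₚ.≤-maximum (f y))
                      (subst (Bool._≤ f y) fxT≡b (mono _ _ (restrict-true-≤ agree)))
    forces false fxT≡b agree =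
      Boolₚ.≤-antisym (subst (f y Bool.≤_) fxT≡b (mono _ _ (≤-restrict-false agree)))
                      (Boolₚ.≤-minimum (f y))

  sufficient-⊆ : ∀ {T U} → T ⊆ U → Sufficient T → Sufficient U
  sufficient-⊆ T⊆U suff = sufficient-forces suff (λ i i∈T → restrict-∈ (T⊆U i∈T))

  sufficient⇒certificate : ∀ {T} → f x ≡ b → Sufficient T → IsCertificate f x T
  sufficient⇒certificate fx≡b suff y agree = trans (sufficient-forces suff agree) (sym fx≡b)

  sufficient-full : ∀ {T} → f x ≡ b → (∀ i → i ∈ T) → Sufficient T
  sufficient-full fx≡b full = trans (monotone-≗ mono (λ i → restrict-∈ (full i))) fx≡b

  sufficient-∩-certificate : ∀ {T S} → Sufficient T → IsCertificate f (restrict b x T) S →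
                             Sufficient (T ∩ S)
  sufficient-∩-certificate {T} {S} suff cert = trans (cert _ agree) suff
    where
    agree : AgreeOn S (restrict b x (T ∩ S)) (restrict b x T)
    agree i i∈S = byMembership (i ∈? T)
      where
      byMembership : Dec (i ∈ T) → restrict b x (T ∩ S) i ≡ restrict b x T i
      byMembership (yes i∈T) = trans (restrict-∈ (x∈p∩q⁺ (i∈T , i∈S))) (sym (restrict-∈ i∈T))
      byMembership (no  i∉T) = trans (restrict-∉ (i∉T ∘ p∩q⊆p T S)) (sym (restrict-∉ i∉T))

  necessary⇒∈certificate : ∀ {T S i} → Sufficient T → IsCertificate f (restrict b x T) S →
                           Necessary T i → i ∈ S
  necessary⇒∈certificate {T} {S} {i} suff cert nec with i ∈? S
  ... | yes i∈S = i∈S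
  ... | no  i∉S =
    contradiction (sufficient-∩-certificate suff cert) (nec (p∩q⊆p T S) (i∉S ∘ p∩q⊆q T S))

  necessary-bound : CertComplexity≤ f k → ∀ {T R} → Sufficient T →
                    (∀ {i} → i ∈ R → Necessary T i) → ∣ R ∣ ≤ k
  necessary-bound cc {T} suff nec with cc (restrict b x T)
  ... | S , cert , |S|≤k = ≤-trans (p⊆q⇒∣p∣≤∣q∣ (necessary⇒∈certificate suff cert ∘ nec)) |S|≤k

module Search {n : ℕ} (x : Input n) (b : Bool) (L : ℕ) where

  prefixProbe : Subset n → ℕ → Input n
  prefixProbe R m = restrict b x (R ∪ below m)

  open Bisection using (bisect; costQ-bisect)

  grow : ℕ → Subset n → Query n (Subset n)
  grow zero    R = return R  -- unreachable: the invariant keeps |R| ≤ k, so k + 1 rounds suffice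
  grow (suc t) R = askIf (restrict b x R) b (return R)
    (bisect (prefixProbe R) b L 0 >>= λ e → grow t (R ∪ at e))

  costQ-grow : ∀ t R f → costQ (grow t R) f ≤ t * suc L
  costQ-grow zero    R f = z≤n
  costQ-grow (suc t) R f = costQ-askIf f z≤n
    (subst (_≤ L + t * suc L) (sym (costQ->>= (bisect (prefixProbe R) b L 0) _ f))
      (+-mono-≤ (costQ-bisect (prefixProbe R) b L 0 f) (costQ-grow t _ f)))

module SearchCorrect {n k : ℕ} {f : BoolFun n} (mono : Monotone f) (cc : CertComplexity≤ f k)
                     (x : Input n) (b : Bool) (L : ℕ) (n≤2^L : n ≤ 2 ^ L) where

  open Sufficiency f mono x b
  open Search x b L
  open Bisection using (bisect; Threshold; bisect-threshold)

  record Invariant (R : Subset n) (m : ℕ) : Set where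
    field
      sufficient : Sufficient (R ∪ below m)
      necessary  : ∀ {i} → i ∈ R → Necessary (R ∪ below m) i

  invariant-size : ∀ {R m} → Invariant R m → ∣ R ∣ ≤ k
  invariant-size inv = necessary-bound cc sufficient necessary
    where open Invariant inv

  module Step {R : Subset n} {m e : ℕ} (inv : Invariant R m)
              (miss : ¬ Sufficient (R ∪ below e)) (hit : Sufficient (R ∪ below (suc e))) where

    open Invariant inv

    e<m : e < m
    e<m = ≰⇒> (miss ∘ λ m≤e → sufficient-⊆ (∪-monoʳ-⊆ (below-mono m≤e)) sufficient)

    e<n : e < n
    e<n = ≰⇒> (miss ∘ λ n≤e → sufficient-⊆ (∪-monoʳ-⊆ (λ {i} _ → below-full n≤e i)) sufficient)

    newPoint : Fin n
    newPoint = fromℕ< e<n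

    newPoint∈at : newPoint ∈ at e
    newPoint∈at = ∈-at⁺ (toℕ-fromℕ< e<n)

    newPoint∉R : newPoint ∉ R
    newPoint∉R newPoint∈R = miss (sufficient-⊆ hit⊆miss hit)
      where
      atR : at e ⊆ R
      atR i∈ = subst (_∈ R) (at-unique newPoint∈at i∈) newPoint∈R
      hit⊆miss : R ∪ below (suc e) ⊆ R ∪ below e
      hit⊆miss = ∪-⊆ (p⊆p∪q _) (∪-⊆ (p⊆p∪q _ ∘ atR) (q⊆p∪q R _) ∘ below-suc)

    size-grows : ∣ R ∣ < ∣ R ∪ at e ∣
    size-grows = p⊂q⇒∣p∣<∣q∣ (p⊆p∪q _ , newPoint , x∈p∪q⁺ (inj₂ newPoint∈at) , newPoint∉R)

    next⊆previous : (R ∪ at e) ∪ below e ⊆ R ∪ below m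
    next⊆previous = ∪-⊆ (∪-monoʳ-⊆ (at⊆below e<m)) (q⊆p∪q R _ ∘ below-mono (<⇒≤ e<m))

    invariant : Invariant (R ∪ at e) e
    invariant = record
      { sufficient = sufficient-⊆ hit⊆next hit
      ; necessary  = λ i∈ → [ necessary-old , necessary-new ]′ (x∈p∪q⁻ R (at e) i∈)
      }
      where
      hit⊆next : R ∪ below (suc e) ⊆ (R ∪ at e) ∪ below e
      hit⊆next = ∪-⊆ (p⊆p∪q _ ∘ p⊆p∪q _)
                    (∪-⊆ (p⊆p∪q _ ∘ q⊆p∪q R _) (q⊆p∪q (R ∪ at e) _) ∘ below-suc)

      necessary-old : ∀ {i} → i ∈ R → Necessary ((R ∪ at e) ∪ below e) i
      necessary-old i∈R U⊆ = necessary i∈R (next⊆previous ∘ U⊆)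

      necessary-new : ∀ {i} → i ∈ at e → Necessary ((R ∪ at e) ∪ below e) i
      necessary-new {i} i∈at {U} U⊆ i∉U = miss ∘ sufficient-⊆ U⊆R∪below
        where
        U⊆R∪below : U ⊆ R ∪ below e
        U⊆R∪below j∈U with x∈p∪q⁻ (R ∪ at e) (below e) (U⊆ j∈U)
        ... | inj₂ j∈below = q⊆p∪q R _ j∈below
        ... | inj₁ j∈R∪at with x∈p∪q⁻ R (at e) j∈R∪at
        ...   | inj₁ j∈R  = p⊆p∪q _ j∈R
        ...   | inj₂ j∈at = contradiction (subst (_∈ U) (at-unique j∈at i∈at) j∈U) i∉U

  grow-correct : ∀ t R m → Invariant R m → k < ∣ R ∣ + t →
                 Sufficient (runQ (grow t R) f) × ∣ runQ (grow t R) f ∣ ≤ k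
  grow-correct zero R m inv k<R =
    contradiction (subst (k <_) (+-identityʳ _) k<R) (≤⇒≯ (invariant-size inv))
  grow-correct (suc t) R m inv k<R+1+t =
    runQ-askIf f Good (λ suff → suff , invariant-size inv) refine
    where
    Good : Subset n → Set
    Good S = Sufficient S × ∣ S ∣ ≤ k
    open Invariant inv
    probe : ℕ → Input n
    probe = prefixProbe R
    refine : ¬ Sufficient R → Good (runQ (bisect probe b L 0 >>= λ e → grow t (R ∪ at e)) f)
    refine insuff = subst Good (sym (runQ->>= (bisect probe b L 0) _ f))
      (grow-correct t (R ∪ at e) e Next.invariant
        (≤-trans k<R+1+t (≤-trans (≤-reflexive (+-suc ∣ R ∣ t)) (+-monoˡ-≤ t Next.size-grows))))
      where
      e : ℕ
      e = runQ (bisect probe b L 0) f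
      threshold : Threshold probe b f e
      threshold = bisect-threshold probe b f L 0
        (insuff ∘ sufficient-⊆ (∪-⊆ (λ i∈ → i∈) (⊥-elim ∘ below-zero)))
        (sufficient-⊆ (∪-monoʳ-⊆ (λ {i} _ → below-full n≤2^L i)) sufficient)
      module Next = Step inv (proj₁ threshold) (proj₂ threshold)

n<2^[1+⌊log₂n⌋] : ∀ n → n < 2 ^ suc ⌊log₂ n ⌋
n<2^[1+⌊log₂n⌋] n with n <? 2 ^ suc ⌊log₂ n ⌋
... | yes n<2^L = n<2^L
... | no  n≮2^L =
  contradiction (subst (_≤ ⌊log₂ n ⌋) (⌊log₂[2^n]⌋≡n _) (⌊log₂⌋-mono-≤ (≮⇒≥ n≮2^L))) 1+n≰n

certify : ∀ n → ℕ → Input n → Query n (Subset n)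
certify n zero    x = return ⊥  -- C(f) ≤ 0 forces f to be constant
certify n (suc a) x = ask x (λ b → Search.grow x b (logFactor n) (suc (suc a)) ⊥)

m≤m^[1+n] : ∀ m n → m ≤ m ^ suc n
m≤m^[1+n] zero      n = z≤n
m≤m^[1+n] m@(suc _) n = m≤m*n m (m ^ n) {{m^n≢0 m n}}

m≤1*m^4 : ∀ m → m ≤ 1 * m ^ 4
m≤1*m^4 m = ≤-trans (m≤m^[1+n] m 3) (≤-reflexive (sym (*-identityˡ _)))

[2+a]*[2+l]<5*[1+a]*[1+l] : ∀ a l → (2 + a) * (2 + l) < 5 * suc a * suc l
[2+a]*[2+l]<5*[1+a]*[1+l] a l = subst (suc ((2 + a) * (2 + l)) ≤_) (sym expand) (m≤m+n _ _)
  where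
  open +-*-Solver
  expand : 5 * suc a * suc l ≡ suc ((2 + a) * (2 + l)) + (3 * a + 3 * l + 4 * a * l)
  expand = solve 2 (λ a l → con 5 :* (con 1 :+ a) :* (con 1 :+ l) :=
             (con 1 :+ (con 2 :+ a) :* (con 2 :+ l)) :+ (con 3 :* a :+ con 3 :* l :+ con 4 :* a :* l))
             refl a l

costQ-certify : ∀ k (x : Input n) f → costQ (certify n k x) f ≤ 5 * k ^ 8 * logFactor n
costQ-certify zero    x f = z≤n
costQ-certify {n} (suc a) x f =
  ≤-trans (s≤s (Search.costQ-grow x (f x) (logFactor n) (suc (suc a)) ⊥ f))
  (≤-trans ([2+a]*[2+l]<5*[1+a]*[1+l] a ⌊log₂ n ⌋)
           (*-monoˡ-≤ (logFactor n) (*-monoʳ-≤ 5 (m≤m^[1+n] (suc a) 7))))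

certify-correct : ∀ {f : BoolFun n} → Monotone f → CertComplexity≤ f k → ∀ x →
                  IsCertificate f x (runQ (certify n k x) f) × ∣ runQ (certify n k x) f ∣ ≤ k
certify-correct {n} {zero} _ cc0 x with cc0 x
... | S , cert , |S|≤0 =
  certificate-⊆ (λ i∈S → contradiction (≤-trans (x∈p⇒∣p-x∣<∣p∣ i∈S) |S|≤0) λ ()) cert
  , ≤-reflexive (∣⊥∣≡0 n)
certify-correct {n} {suc a} {f} mono cc x =
  map₁ (sufficient⇒certificate refl) (grow-correct (suc (suc a)) ⊥ n initial enoughRounds)
  where
  open Sufficiency f mono x (f x)
  open SearchCorrect mono cc x (f x) (logFactor n) (<⇒≤ (n<2^[1+⌊log₂n⌋] n))
  initial : Invariant ⊥ n
  initial = record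
    { sufficient = sufficient-full refl (λ i → q⊆p∪q ⊥ _ (below-full ≤-refl i))
    ; necessary  = ⊥-elim ∘ ∉⊥
    }
  enoughRounds : suc a < ∣ ⊥ {n} ∣ + suc (suc a)
  enoughRounds = subst (λ z → suc a < z + suc (suc a)) (sym (∣⊥∣≡0 n)) (n<1+n (suc a))

deterministic-success : ∀ {n c} {P : Vec Bool 0 → Set} → P [] → ProbAtLeast1-1/n^ 0 n c P
deterministic-success {n} {c} p =
  [] ∷ List.[] , All.[] AllPairs.∷ AllPairs.[] , p All.∷ All.[] ,
  m≤m+n (1 * n ^ c) 1

corollary6p1 :
    ∀ (c : ℕ) →
    Σ ℕ λ c₁ → Σ ℕ λ c₂ →
    ∀ (n k : ℕ) (xstar : Input n) →
    Σ ℕ λ r → Σ (RandQueryAlg n r) λ A →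
    ∀ (f : BoolFun n) → Monotone f → CertComplexity≤ f k →
      (∀ s → cost (A s) f ≤ c₂ * k ^ 8 * logFactor n)
      × ProbAtLeast1-1/n^ r n c
          (λ s → IsCertificate f xstar (run (A s) f)
                 × ∣ run (A s) f ∣ ≤ c₁ * k ^ 4)
corollary6p1 c = 1 , 5 , λ n k x → 0 , (λ _ → toTree (certify n k x)) , λ f mono cc →
  (λ _ → subst (_≤ 5 * k ^ 8 * logFactor n) (sym (cost-toTree _ f)) (costQ-certify k x f)) ,
  deterministic-success {c = c}
    (subst (λ S → IsCertificate f x S × ∣ S ∣ ≤ 1 * k ^ 4) (sym (run-toTree (certify n k x) f))
      (map₂ (λ size → ≤-trans size (m≤1*m^4 k)) (certify-correct mono cc x)))
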